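{- For all integers $v\ge4$ and $d\ge1$, \[\left|\mathcal{D}_{v,d}(132, 321)\right| = \left|\mathcal{D}_{v,d}(213, 321)\right| = 1+v\,\frac{d(d-1)}{2}.\]
   Context: A diamond with $v$ vertices ($v\ge4$) is the poset with a least element, a greatest element, and $v-2$ pairwise incomparable middle elements (in a fixed left-to-right order) strictly between them. $\mathcal{D}_{v,d}$ is the set of labellings of $d$ diamonds (placed left to right) by $1,\dots,vd$, each label used once, such that in each diamond least label $<$ each middle label $<$ greatest label. For $D\in\mathcal{D}_{v,d}$, $\pi_D$ is the permutation obtained by reading the diamonds left to right and, within each diamond, the least element, then the middle elements left to right, then the greatest element. $\mathcal{D}_{v,d}(P)$ is the set of $D$ with $\pi_D$ avoiding every classical pattern in $P$. -}

module Defs where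

open import Data.Nat using (ℕ; zero; suc; _+_; _*_; _∸_; _<_)
open import Data.Product using (Σ; _×_; _,_)
open import Data.List using (List; []; _∷_; _++_; [_]; length; concatMap; map; upTo)
open import Data.List.Relation.Unary.All using (All)
open import Data.List.Relation.Binary.Pointwise using (Pointwise)
open import Data.List.Relation.Binary.Sublist.Propositional using (_⊆_)
open import Data.List.Relation.Binary.Permutation.Propositional using (_↭_)
open import Data.List.Relation.Unary.Unique.Propositional using (Unique)
open import Data.List.Membership.Propositional using (_∈_)
open import Relation.Binary.PropositionalEquality using (_≡_)
open import Relation.Nullary using (¬_)
open import Function.Bundles using (_⇔_)

-- A single labelled diamond: (least label, middle labels left to right, greatest label).
Diamond : Set
Diamond = ℕ × List ℕ × ℕ

readDiamond : Diamond → List ℕ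
readDiamond (b , m , t) = b ∷ m ++ [ t ]

perm : List Diamond → List ℕ
perm = concatMap readDiamond

WellLabelled : ℕ → Diamond → Set
WellLabelled v (b , m , t) = length m ≡ v ∸ 2 × All (λ x → b < x × x < t) m

oneTo : ℕ → List ℕ
oneTo n = map suc (upTo n)

IsDiamondLabelling : ℕ → ℕ → List Diamond → Set
IsDiamondLabelling v d D =
  length D ≡ d × All (WellLabelled v) D × perm D ↭ oneTo (v * d)

data OrderIso : List ℕ → List ℕ → Set where
  []  : OrderIso [] []
  _∷_ : ∀ {x y xs ys} →
        Pointwise (λ x′ y′ → (x < x′) ⇔ (y < y′)) xs ys →
        OrderIso xs ys → OrderIso (x ∷ xs) (y ∷ ys)

Contains : List ℕ → List ℕ → Set
Contains π p = Σ (List ℕ) (λ σ → σ ⊆ π × OrderIso σ p)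

Avoids : List ℕ → List (List ℕ) → Set
Avoids π P = All (λ p → ¬ Contains π p) P

𝒟 : ℕ → ℕ → List (List ℕ) → List Diamond → Set
𝒟 v d P D = IsDiamondLabelling v d D × Avoids (perm D) P

HasCard : {A : Set} → (A → Set) → ℕ → Set
HasCard {A} Q n =
  Σ (List A) (λ L → Unique L × length L ≡ n × (∀ x → Q x ⇔ (x ∈ L)))

p132 p321 p213 : List ℕ
p132 = 1 ∷ 3 ∷ 2 ∷ []
p321 = 3 ∷ 2 ∷ 1 ∷ []
p213 = 2 ∷ 1 ∷ 3 ∷ []

-- Avoiding 132 (or 213) forces the middle labels of every diamond to increase, so the reading
-- word π_D is a concatenation of increasing blocks of length v.  Unless π_D is the identity,
-- its first descent x > y lies between two diamonds, and avoiding 321 together with 132 (or 213)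
-- makes everything from y on increase.  So π_D is a permutation of 1 … vd with two increasing
-- runs, of lengths α = va and β = vp where a + p = d.  Such a 132-avoider is
-- (j+1 … j+α)(1 … j)(j+α+1 … α+β) with 1 ≤ j ≤ β, and such a 213-avoider is
-- (1 … j)(j+β+1 … α+β)(j+1 … j+β) with 0 ≤ j < α; conversely, each of these words cut into d
-- blocks is a labelling in the class.  Together with the identity this gives
-- 1 + Σ_{p=1}^{d-1} vp = 1 + v·d(d-1)/2 labellings in either case.

module Submission where

open import Defs
open import Data.Nat
  using (ℕ; zero; suc; _+_; _*_; _∸_; _≤_; _<_; _≮_; _/_; z≤n; s≤s; z<s; s<s; _<?_)
open import Data.Nat.Properties
open import Data.Nat.ListAction using (sum)
open import Data.Nat.ListAction.Properties using (sum-++)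
open import Data.Nat.DivMod using (m*n/n≡m)
open import Data.Nat.Tactic.RingSolver using (solve-∀)
open import Data.List
  using (List; []; _∷_; _++_; [_]; length; concatMap; map; iterate; applyUpTo; take; drop; head)
open import Data.List.Properties
  using ( length-++; length-++-≤ˡ; length-map; length-iterate; ++-assoc; ++-identityʳ
        ; map-∘; map-id-local; map-applyUpTo; concatMap-++; ∷-injectiveˡ; ∷-injectiveʳ)
open import Data.List.Relation.Unary.All as All using (All; []; _∷_)
import Data.List.Relation.Unary.All.Properties as All
open import Data.List.Relation.Unary.Any using (here; there)
open import Data.List.Relation.Unary.AllPairs as AllPairs using (AllPairs; []; _∷_)
import Data.List.Relation.Unary.AllPairs.Properties as AllPairs
open import Data.List.Relation.Unary.Unique.Propositional using (Unique)
import Data.List.Relation.Unary.Unique.Propositional.Properties as Unique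
open import Data.List.Relation.Unary.Sorted.TotalOrder.Properties using (↗↭↗⇒≋; AllPairs⇒Sorted)
open import Data.List.Relation.Binary.Equality.Propositional using (≋⇒≡)
open import Data.List.Relation.Binary.Permutation.Propositional
  using (_↭_; ↭-refl; ↭-sym; ↭-trans; ↭⇒↭ₛ; module PermutationReasoning)
import Data.List.Relation.Binary.Permutation.Propositional.Properties as Perm
import Data.List.Relation.Binary.Permutation.Setoid.Properties as PermSetoid
open import Data.List.Relation.Binary.Sublist.Propositional
  using (_⊆_; []; _∷_; _∷ʳ_; ⊆-refl; ⊆-trans; from∈; to∈)
open import Data.List.Relation.Binary.Sublist.Propositional.Properties
  using (++⁺; ++⁺ˡ; ++⁺ʳ; ∷ˡ⁻; All-resp-⊆)
open import Data.List.Relation.Binary.Pointwise using ([]; _∷_)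
open import Data.List.Membership.Propositional using (_∈_; find)
import Data.List.Membership.Propositional.Properties as ∈
open import Data.Product using (Σ; _×_; _,_; proj₁; proj₂)
open import Data.Sum as Sum using (_⊎_; inj₁; inj₂)
open import Data.Maybe using (Maybe; just)
open import Data.Maybe.Properties using (just-injective)
open import Data.Empty using (⊥; ⊥-elim)
open import Function using (_∘_)
open import Function.Bundles using (_⇔_; mk⇔; Equivalence)
open import Relation.Nullary using (¬_; yes; no)
open import Relation.Nullary.Decidable using (decidable-stable)
open import Relation.Binary.PropositionalEquality
  using (_≡_; _≢_; ≢-sym; refl; sym; trans; cong; cong₂; subst; subst₂; setoid; module ≡-Reasoning)

interval : ℕ → ℕ → List ℕ
interval = iterate suc

length-interval : ∀ s l → length (interval s l) ≡ l
length-interval = length-iterate suc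

interval-++ : ∀ s a b → interval s (a + b) ≡ interval s a ++ interval (s + a) b
interval-++ s zero    b = cong (λ t → interval t b) (sym (+-identityʳ s))
interval-++ s (suc a) b = cong (s ∷_) (trans (interval-++ (suc s) a b)
                                         (cong (λ t → interval (suc s) a ++ interval t b) (sym (+-suc s a))))

∈-interval⁻ : ∀ {x} s l → x ∈ interval s l → s ≤ x × x < s + l
∈-interval⁻ s (suc l) (here refl) = ≤-refl , m<m+n s z<s
∈-interval⁻ {x} s (suc l) (there x∈) with ∈-interval⁻ (suc s) l x∈
... | s<x , x<s+l = <⇒≤ s<x , subst (x <_) (sym (+-suc s l)) x<s+l

∈-interval⁺ : ∀ {x} s l → s ≤ x → x < s + l → x ∈ interval s l
∈-interval⁺ s zero    s≤x x<s+0 = ⊥-elim (<⇒≱ x<s+0 (subst (_≤ _) (sym (+-identityʳ s)) s≤x))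
∈-interval⁺ {x} s (suc l) s≤x x<s+l with s ≟ x
... | yes refl = here refl
... | no s≢x   = there (∈-interval⁺ (suc s) l (≤∧≢⇒< s≤x s≢x) (subst (x <_) (+-suc s l) x<s+l))

applyUpTo≡interval : ∀ (f : ℕ → ℕ) s n → (∀ i → f i ≡ s + i) → applyUpTo f n ≡ interval s n
applyUpTo≡interval f s zero    f≡ = refl
applyUpTo≡interval f s (suc n) f≡ = cong₂ _∷_ (trans (f≡ 0) (+-identityʳ s))
  (applyUpTo≡interval (f ∘ suc) (suc s) n (λ i → trans (f≡ (suc i)) (+-suc s i)))

oneTo≡interval : ∀ n → oneTo n ≡ interval 1 n
oneTo≡interval n = trans (map-applyUpTo (λ i → i) suc n) (applyUpTo≡interval suc 1 n (λ _ → refl))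

Increasing : List ℕ → Set
Increasing = AllPairs _<_

interval-increasing : ∀ s l → Increasing (interval s l)
interval-increasing s zero    = []
interval-increasing s (suc l) =
  All.tabulate (proj₁ ∘ ∈-interval⁻ (suc s) l) ∷ interval-increasing (suc s) l

AllPairs-resp-⊆ : ∀ {A : Set} {R : A → A → Set} {xs ys} → xs ⊆ ys → AllPairs R ys → AllPairs R xs
AllPairs-resp-⊆ []         _        = []
AllPairs-resp-⊆ (_ ∷ʳ τ)   (_ ∷ r)  = AllPairs-resp-⊆ τ r
AllPairs-resp-⊆ (refl ∷ τ) (x~ ∷ r) = All-resp-⊆ τ x~ ∷ AllPairs-resp-⊆ τ r

AllPairs-pair : ∀ {A : Set} {R : A → A → Set} {x y xs} → x ∷ y ∷ [] ⊆ xs → AllPairs R xs → R x y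
AllPairs-pair τ r with AllPairs-resp-⊆ τ r
... | (x~y ∷ []) ∷ _ = x~y

increasing-fromPairs : ∀ xs → (∀ {x y} → x ∷ y ∷ [] ⊆ xs → x < y) → Increasing xs
increasing-fromPairs []       _     = []
increasing-fromPairs (x ∷ xs) pair< =
  All.tabulate (λ y∈ → pair< (refl ∷ from∈ y∈)) ∷ increasing-fromPairs xs (pair< ∘ (x ∷ʳ_))

increasing-++⁺ : ∀ {A B} → Increasing A → Increasing B → (∀ {a b} → a ∈ A → b ∈ B → a < b) →
                 Increasing (A ++ B)
increasing-++⁺ iA iB A<B = AllPairs.++⁺ iA iB (All.tabulate λ a∈ → All.tabulate (A<B a∈))

increasing-++⁻ : ∀ A {B} → Increasing (A ++ B) →
                 Increasing A × Increasing B × (∀ {a b} → a ∈ A → b ∈ B → a < b)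
increasing-++⁻ A {B} i =
  AllPairs-resp-⊆ (++⁺ʳ B ⊆-refl) i , AllPairs-resp-⊆ (++⁺ˡ A ⊆-refl) i ,
  λ a∈ b∈ → AllPairs-pair (++⁺ (from∈ a∈) (from∈ b∈)) i

increasing-↭⇒≡ : ∀ {xs ys} → Increasing xs → Increasing ys → xs ↭ ys → xs ≡ ys
increasing-↭⇒≡ ixs iys p = ≋⇒≡ (↗↭↗⇒≋ ≤-totalOrder (sorted ixs) (sorted iys) (↭⇒↭ₛ p))
  where
  sorted = λ {zs} (i : Increasing zs) → AllPairs⇒Sorted ≤-totalOrder (AllPairs.map <⇒≤ i)

interval-++⁻ : ∀ X {Y} s l → X ++ Y ≡ interval s l →
               X ≡ interval s (length X) × Y ≡ interval (s + length X) (length Y)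
interval-++⁻ []      {Y} s l       e = refl ,
  trans e (cong₂ interval (sym (+-identityʳ s)) (trans (sym (length-interval s l)) (cong length (sym e))))
interval-++⁻ (x ∷ X) {Y} s (suc l) e with interval-++⁻ X (suc s) l (∷-injectiveʳ e)
... | eX , eY =
  cong₂ _∷_ (∷-injectiveˡ e) eX , trans eY (cong (λ t → interval t (length Y)) (sym (+-suc s (length X))))

increasing-↭-interval : ∀ X Y Z {n} → Increasing (X ++ Y ++ Z) → X ++ Y ++ Z ↭ interval 1 n →
  X ≡ interval 1 (length X) × Y ≡ interval (suc (length X)) (length Y) ×
  Z ≡ interval (suc (length X + length Y)) (length Z)
increasing-↭-interval X Y Z {n} i p with interval-++⁻ X 1 n (increasing-↭⇒≡ i (interval-increasing 1 n) p)
... | eX , eYZ with interval-++⁻ Y (suc (length X)) (length (Y ++ Z)) eYZ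
...   | eY , eZ = eX , eY , eZ

-- Patterns of length three

1<2 : 1 < 2
1<2 = n<1+n 1

2<3 : 2 < 3
2<3 = n<1+n 2

1<3 : 1 < 3
1<3 = s<s z<s

both : ∀ {P Q : Set} → P → Q → P ⇔ Q
both p q = mk⇔ (λ _ → q) (λ _ → p)

neither : ∀ {P Q : Set} → ¬ P → ¬ Q → P ⇔ Q
neither ¬p ¬q = mk⇔ (⊥-elim ∘ ¬p) (⊥-elim ∘ ¬q)

contains-pattern : ∀ {π x y z a b c} → x ∷ y ∷ z ∷ [] ⊆ π →
  (x < y ⇔ a < b) → (x < z ⇔ a < c) → (y < z ⇔ b < c) → Contains π (a ∷ b ∷ c ∷ [])
contains-pattern τ xy xz yz = _ , τ , (xy ∷ xz ∷ []) ∷ (yz ∷ []) ∷ [] ∷ []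

record Occurrence (π : List ℕ) (a b c : ℕ) : Set where
  constructor occurrence
  field
    {x y z} : ℕ
    sublist : x ∷ y ∷ z ∷ [] ⊆ π
    xy      : x < y ⇔ a < b
    xz      : x < z ⇔ a < c
    yz      : y < z ⇔ b < c

occurrence-of : ∀ {π a b c} → Contains π (a ∷ b ∷ c ∷ []) → Occurrence π a b c
occurrence-of (_ , τ , (xy ∷ xz ∷ []) ∷ (yz ∷ []) ∷ [] ∷ []) = occurrence τ xy xz yz

contains-321 : ∀ {π x y z} → x ∷ y ∷ z ∷ [] ⊆ π → x ≮ y → x ≮ z → y ≮ z → Contains π p321
contains-321 τ x≮y x≮z y≮z =
  contains-pattern τ (neither x≮y (<⇒≯ 2<3)) (neither x≮z (<⇒≯ 1<3)) (neither y≮z (<⇒≯ 1<2))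

contains-132 : ∀ {π x y z} → x ∷ y ∷ z ∷ [] ⊆ π → x < y → x < z → y ≮ z → Contains π p132
contains-132 τ x<y x<z y≮z = contains-pattern τ (both x<y 1<3) (both x<z 1<2) (neither y≮z (<⇒≯ 2<3))

contains-213 : ∀ {π x y z} → x ∷ y ∷ z ∷ [] ⊆ π → x ≮ y → x < z → y < z → Contains π p213
contains-213 τ x≮y x<z y<z = contains-pattern τ (neither x≮y (<⇒≯ 1<2)) (both x<z 2<3) (both y<z 1<3)

avoids-⊆ : ∀ {xs ys p} → xs ⊆ ys → ¬ Contains ys p → ¬ Contains xs p
avoids-⊆ τ ¬c (σ , σ⊆ , iso) = ¬c (σ , ⊆-trans σ⊆ τ , iso)

⊆-++-split : ∀ {σ : List ℕ} H K → σ ⊆ H ++ K →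
  Σ (List ℕ) λ σ₁ → Σ (List ℕ) λ σ₂ → σ ≡ σ₁ ++ σ₂ × σ₁ ⊆ H × σ₂ ⊆ K
⊆-++-split []      K τ          = [] , _ , refl , [] , τ
⊆-++-split (h ∷ H) K (.h ∷ʳ τ) with ⊆-++-split H K τ
... | σ₁ , σ₂ , refl , τ₁ , τ₂ = σ₁ , σ₂ , refl , h ∷ʳ τ₁ , τ₂
⊆-++-split (h ∷ H) K (refl ∷ τ) with ⊆-++-split H K τ
... | σ₁ , σ₂ , refl , τ₁ , τ₂ = h ∷ σ₁ , σ₂ , refl , refl ∷ τ₁ , τ₂

data Straddle (H K : List ℕ) (x y z : ℕ) : Set where
  ascending  : x < y → y < z → Straddle H K x y z
  twoThenOne : x ∈ H → y ∈ H → z ∈ K → x < y → Straddle H K x y z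
  oneThenTwo : x ∈ H → y ∈ K → z ∈ K → y < z → Straddle H K x y z

ascending-inside : ∀ {x y z xs} → x ∷ y ∷ z ∷ [] ⊆ xs → Increasing xs → ∀ {H K} → Straddle H K x y z
ascending-inside τ i with AllPairs-resp-⊆ τ i
... | (x<y ∷ _) ∷ (y<z ∷ []) ∷ _ = ascending x<y y<z

straddle : ∀ {H K x y z} → Increasing H → Increasing K → x ∷ y ∷ z ∷ [] ⊆ H ++ K → Straddle H K x y z
straddle {H} {K} iH iK τ with ⊆-++-split H K τ
... | []             , _  , refl , _  , τ₂ = ascending-inside τ₂ iK
... | _ ∷ []         , _  , refl , τ₁ , τ₂ = oneThenTwo (to∈ τ₁) (to∈ τ₂) (to∈ (∷ˡ⁻ τ₂)) (AllPairs-pair τ₂ iK)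
... | _ ∷ _ ∷ []     , _  , refl , τ₁ , τ₂ = twoThenOne (to∈ τ₁) (to∈ (∷ˡ⁻ τ₁)) (to∈ τ₂) (AllPairs-pair τ₁ iH)
... | _ ∷ _ ∷ _ ∷ [] , [] , refl , τ₁ , _  = ascending-inside τ₁ iH

Separated : ℕ → List ℕ → Set
Separated x L = All (_< x) L ⊎ All (x <_) L

twoRuns-avoid-321 : ∀ {H K} → Increasing H → Increasing K → ¬ Contains (H ++ K) p321
twoRuns-avoid-321 iH iK c with occurrence-of c
... | occurrence τ xy _ yz with straddle iH iK τ
...   | ascending x<y _        = <⇒≯ 2<3 (Equivalence.to xy x<y)
...   | twoThenOne _ _ _ x<y   = <⇒≯ 2<3 (Equivalence.to xy x<y)
...   | oneThenTwo _ _ _ y<z   = <⇒≯ 1<2 (Equivalence.to yz y<z)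

twoRuns-avoid-132 : ∀ {H K} → Increasing H → Increasing K → (∀ {k} → k ∈ K → Separated k H) →
                    ¬ Contains (H ++ K) p132
twoRuns-avoid-132 iH iK sep c with occurrence-of c
... | occurrence τ _ xz yz with straddle iH iK τ | Equivalence.from xz 1<2
...   | ascending _ y<z      | _   = <⇒≯ 2<3 (Equivalence.to yz y<z)
...   | oneThenTwo _ _ _ y<z | _   = <⇒≯ 2<3 (Equivalence.to yz y<z)
...   | twoThenOne x∈ y∈ z∈ _ | x<z with sep z∈
...     | inj₁ H<z = <⇒≯ 2<3 (Equivalence.to yz (All.lookup H<z y∈))
...     | inj₂ z<H = <-asym x<z (All.lookup z<H x∈)

twoRuns-avoid-213 : ∀ {H K} → Increasing H → Increasing K → (∀ {h} → h ∈ H → Separated h K) →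
                    ¬ Contains (H ++ K) p213
twoRuns-avoid-213 iH iK sep c with occurrence-of c
... | occurrence τ xy xz _ with straddle iH iK τ | Equivalence.from xz 2<3
...   | ascending x<y _      | _   = <⇒≯ 1<2 (Equivalence.to xy x<y)
...   | twoThenOne _ _ _ x<y | _   = <⇒≯ 1<2 (Equivalence.to xy x<y)
...   | oneThenTwo x∈ y∈ z∈ _ | x<z with sep x∈
...     | inj₁ K<x = <-asym x<z (All.lookup K<x z∈)
...     | inj₂ x<K = <⇒≯ 1<2 (Equivalence.to xy (All.lookup x<K y∈))

-- Cutting a word into diamonds

take-length-++ : ∀ {A : Set} (xs ys : List A) → take (length xs) (xs ++ ys) ≡ xs
take-length-++ []       ys = refl
take-length-++ (x ∷ xs) ys = cong (x ∷_) (take-length-++ xs ys)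

drop-length-++ : ∀ {A : Set} (xs ys : List A) → drop (length xs) (xs ++ ys) ≡ ys
drop-length-++ []       ys = refl
drop-length-++ (x ∷ xs) ys = drop-length-++ xs ys

chunk : ℕ → ℕ → List ℕ → List Diamond
chunk m zero    w       = []
chunk m (suc d) []      = []
chunk m (suc d) (b ∷ w) = close (take m w) (drop m w)
  where
  close : List ℕ → List ℕ → List Diamond
  close ms []      = []
  close ms (t ∷ r) = (b , ms , t) ∷ chunk m d r

chunk-∷ : ∀ {m} d b ms t r → length ms ≡ m → chunk m (suc d) (b ∷ ms ++ t ∷ r) ≡ (b , ms , t) ∷ chunk m d r
chunk-∷ d b ms t r refl rewrite take-length-++ ms (t ∷ r) | drop-length-++ ms (t ∷ r) = refl

perm-∷ : ∀ b ms t D → perm ((b , ms , t) ∷ D) ≡ b ∷ ms ++ t ∷ perm D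
perm-∷ b ms t D = cong (b ∷_) (++-assoc ms [ t ] (perm D))

chunk-perm : ∀ m D → All (WellLabelled (2 + m)) D → chunk m (length D) (perm D) ≡ D
chunk-perm m []                  []                 = refl
chunk-perm m ((b , ms , t) ∷ D) ((|ms| , _) ∷ wl) = begin
  chunk m (suc (length D)) (perm ((b , ms , t) ∷ D))  ≡⟨ cong (chunk m _) (perm-∷ b ms t D) ⟩
  chunk m (suc (length D)) (b ∷ ms ++ t ∷ perm D)     ≡⟨ chunk-∷ (length D) b ms t (perm D) |ms| ⟩
  (b , ms , t) ∷ chunk m (length D) (perm D)          ≡⟨ cong ((b , ms , t) ∷_) (chunk-perm m D wl) ⟩
  (b , ms , t) ∷ D                                    ∎
  where open ≡-Reasoning

length-perm : ∀ m D → All (WellLabelled (2 + m)) D → length (perm D) ≡ (2 + m) * length D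
length-perm m []                  []                 = sym (*-zeroʳ (2 + m))
length-perm m ((b , ms , t) ∷ D) ((|ms| , _) ∷ wl) = begin
  length (perm ((b , ms , t) ∷ D))         ≡⟨ cong length (perm-∷ b ms t D) ⟩
  suc (length (ms ++ t ∷ perm D))          ≡⟨ cong suc (length-++ ms) ⟩
  suc (length ms + suc (length (perm D)))  ≡⟨ cong (λ l → suc (l + suc (length (perm D)))) |ms| ⟩
  suc (m + suc (length (perm D)))          ≡⟨ cong suc (+-suc m _) ⟩
  2 + m + length (perm D)                  ≡⟨ cong (2 + m +_) (length-perm m D wl) ⟩
  2 + m + (2 + m) * length D               ≡⟨ *-suc (2 + m) (length D) ⟨
  (2 + m) * suc (length D)                 ∎
  where open ≡-Reasoning

data DiamondView (m n : ℕ) : List ℕ → Set where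
  diamond : ∀ b ms t r → length ms ≡ m → length r ≡ n → DiamondView m n (b ∷ ms ++ t ∷ r)

diamondView : ∀ m n w → length w ≡ 2 + m + n → DiamondView m n w
diamondView zero    n (b ∷ t ∷ r) |w| = diamond b [] t r refl (suc-injective (suc-injective |w|))
diamondView (suc m) n (b ∷ x ∷ w) |w| with diamondView m n (b ∷ w) (suc-injective |w|)
... | diamond b ms t r |ms| |r| = diamond b (x ∷ ms) t r (cong suc |ms|) |r|

firstDiamond : ∀ m d w → length w ≡ (2 + m) * suc d → DiamondView m ((2 + m) * d) w
firstDiamond m d w |w| = diamondView m _ w (trans |w| (*-suc (2 + m) d))

perm-chunk : ∀ m d w → length w ≡ (2 + m) * d → perm (chunk m d w) ≡ w
perm-chunk m zero    []      _   = refl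
perm-chunk m zero    (_ ∷ _) |w| with () ← trans |w| (*-zeroʳ (2 + m))
perm-chunk m (suc d) w       |w| with firstDiamond m d w |w|
... | diamond b ms t r |ms| |r| = begin
  perm (chunk m (suc d) (b ∷ ms ++ t ∷ r))  ≡⟨ cong perm (chunk-∷ d b ms t r |ms|) ⟩
  perm ((b , ms , t) ∷ chunk m d r)         ≡⟨ perm-∷ b ms t (chunk m d r) ⟩
  b ∷ ms ++ t ∷ perm (chunk m d r)          ≡⟨ cong (λ r′ → b ∷ ms ++ t ∷ r′) (perm-chunk m d r |r|) ⟩
  b ∷ ms ++ t ∷ r                           ∎
  where open ≡-Reasoning

length-chunk : ∀ m d w → length w ≡ (2 + m) * d → length (chunk m d w) ≡ d
length-chunk m zero    w _   = refl
length-chunk m (suc d) w |w| with firstDiamond m d w |w|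
... | diamond b ms t r |ms| |r| =
  trans (cong length (chunk-∷ d b ms t r |ms|)) (cong suc (length-chunk m d r |r|))

chunk-++ : ∀ m a b A B → length A ≡ (2 + m) * a → chunk m (a + b) (A ++ B) ≡ chunk m a A ++ chunk m b B
chunk-++ m zero    b []      B _   = refl
chunk-++ m zero    b (_ ∷ _) B |A| with () ← trans |A| (*-zeroʳ (2 + m))
chunk-++ m (suc a) b A       B |A| with firstDiamond m a A |A|
... | diamond x ms t r |ms| |r| = begin
  chunk m (suc a + b) ((x ∷ ms ++ t ∷ r) ++ B)
    ≡⟨ cong (λ w → chunk m (suc a + b) (x ∷ w)) (++-assoc ms (t ∷ r) B) ⟩
  chunk m (suc a + b) (x ∷ ms ++ t ∷ r ++ B)    ≡⟨ chunk-∷ (a + b) x ms t (r ++ B) |ms| ⟩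
  (x , ms , t) ∷ chunk m (a + b) (r ++ B)       ≡⟨ cong ((x , ms , t) ∷_) (chunk-++ m a b r B |r|) ⟩
  (x , ms , t) ∷ chunk m a r ++ chunk m b B     ≡⟨ cong (_++ chunk m b B) (chunk-∷ a x ms t r |ms|) ⟨
  chunk m (suc a) (x ∷ ms ++ t ∷ r) ++ chunk m b B ∎
  where open ≡-Reasoning

chunk-wellLabelled : ∀ m d w → length w ≡ (2 + m) * d → Increasing w →
                     All (WellLabelled (2 + m)) (chunk m d w)
chunk-wellLabelled m zero    w _   _ = []
chunk-wellLabelled m (suc d) w |w| i with firstDiamond m d w |w|
... | diamond b ms t r |ms| |r| with i
...   | b< ∷ i′ with increasing-++⁻ ms i′
...     | _ , (_ ∷ iᵣ) , ms<t∷r =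
  subst (All (WellLabelled (2 + m))) (sym (chunk-∷ d b ms t r |ms|))
    ((|ms| , All.tabulate (λ x∈ → All.lookup b< (∈.∈-++⁺ˡ x∈) , ms<t∷r x∈ (here refl)))
     ∷ chunk-wellLabelled m d r |r| iᵣ)

IsReading : ℕ → ℕ → List (List ℕ) → List ℕ → Set
IsReading v d P w = Σ (List Diamond) λ D → 𝒟 v d P D × perm D ≡ w

twoRuns-isReading : ∀ m a b P {H K} → Increasing H → Increasing K →
  length H ≡ (2 + m) * a → length K ≡ (2 + m) * b → H ++ K ↭ interval 1 ((2 + m) * (a + b)) →
  Avoids (H ++ K) P → IsReading (2 + m) (a + b) P (H ++ K)
twoRuns-isReading m a b P {H} {K} iH iK |H| |K| H++K↭ avoids =
  D , ((length-chunk m (a + b) (H ++ K) |H++K| , wellLabelled , labels) ,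
       subst (λ π → Avoids π P) (sym perm≡) avoids) ,
  perm≡
  where
  D = chunk m (a + b) (H ++ K)
  |H++K| : length (H ++ K) ≡ (2 + m) * (a + b)
  |H++K| = trans (length-++ H) (trans (cong₂ _+_ |H| |K|) (sym (*-distribˡ-+ (2 + m) a b)))
  perm≡ : perm D ≡ H ++ K
  perm≡ = perm-chunk m (a + b) (H ++ K) |H++K|
  wellLabelled : All (WellLabelled (2 + m)) D
  wellLabelled = subst (All (WellLabelled (2 + m))) (sym (chunk-++ m a b H K |H|))
    (All.++⁺ (chunk-wellLabelled m a H |H| iH) (chunk-wellLabelled m b K |K| iK))
  labels : perm D ↭ oneTo ((2 + m) * (a + b))
  labels = subst₂ _↭_ (sym perm≡) (sym (oneTo≡interval _)) H++K↭

chunk-perm-𝒟 : ∀ {m d P D} → 𝒟 (2 + m) d P D → chunk m d (perm D) ≡ D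
chunk-perm-𝒟 {m} {D = D} ((refl , wl , _) , _) = chunk-perm m D wl

chunk-∈-𝒟 : ∀ {m d P w} → IsReading (2 + m) d P w → 𝒟 (2 + m) d P (chunk m d w)
chunk-∈-𝒟 {m} {d} {P} (D , D∈ , refl) = subst (𝒟 (2 + m) d P) (sym (chunk-perm-𝒟 D∈)) D∈

perm-chunk-reading : ∀ {m d P w} → IsReading (2 + m) d P w → perm (chunk m d w) ≡ w
perm-chunk-reading (D , D∈ , refl) = cong perm (chunk-perm-𝒟 D∈)

-- A labelling is recovered from its reading word by chunk, so counting 𝒟_{v,d}(P) amounts to
-- counting reading words.
hasCard-of-readings : ∀ m d P (W : List (List ℕ)) → Unique W →
  (∀ {w} → w ∈ W → IsReading (2 + m) d P w) → (∀ {D} → 𝒟 (2 + m) d P D → perm D ∈ W) →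
  HasCard (𝒟 (2 + m) d P) (length W)
hasCard-of-readings m d P W unique sound complete =
  map (chunk m d) W , unique-chunks , length-map (chunk m d) W , λ D → mk⇔ (to D) from
  where
  unique-chunks : Unique (map (chunk m d) W)
  unique-chunks = Unique.map⁻ (subst Unique (sym perm∘chunk) unique)
    where
    perm∘chunk : map perm (map (chunk m d) W) ≡ W
    perm∘chunk = trans (sym (map-∘ W)) (map-id-local (All.tabulate (perm-chunk-reading ∘ sound)))
  to : ∀ D → 𝒟 (2 + m) d P D → D ∈ map (chunk m d) W
  to D D∈ = subst (_∈ map (chunk m d) W) (chunk-perm-𝒟 D∈) (∈.∈-map⁺ (chunk m d) (complete D∈))
  from : ∀ {D} → D ∈ map (chunk m d) W → 𝒟 (2 + m) d P D
  from D∈ with ∈.∈-map⁻ (chunk m d) D∈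
  ... | w , w∈ , refl = chunk-∈-𝒟 (sound w∈)

-- The two families of two-run permutations

word132 : ℕ → ℕ → ℕ → List ℕ
word132 α β j = interval (suc j) α ++ (interval 1 j ++ interval (suc (j + α)) (β ∸ j))

word213 : ℕ → ℕ → ℕ → List ℕ
word213 α β j = (interval 1 j ++ interval (suc (j + β)) (α ∸ j)) ++ interval (suc j) β

intervals-increasing : ∀ {s l s′} l′ → s + l ≤ s′ → Increasing (interval s l ++ interval s′ l′)
intervals-increasing {s} {l} {s′} l′ s+l≤s′ =
  increasing-++⁺ (interval-increasing s l) (interval-increasing s′ l′) λ a∈ b∈ →
    <-≤-trans (proj₂ (∈-interval⁻ s l a∈)) (≤-trans s+l≤s′ (proj₁ (∈-interval⁻ s′ l′ b∈)))

length-intervals : ∀ s s′ {j l} → j ≤ l → length (interval s j ++ interval s′ (l ∸ j)) ≡ l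
length-intervals s s′ {j} {l} j≤l =
  trans (length-++ (interval s j))
        (trans (cong₂ _+_ (length-interval s j) (length-interval s′ (l ∸ j))) (m+[n∸m]≡n j≤l))

+-∸-shuffle : ∀ α {β j} → j ≤ β → j + (α + (β ∸ j)) ≡ α + β
+-∸-shuffle α {β} {j} j≤β = begin
  j + (α + (β ∸ j))  ≡⟨ +-assoc j α (β ∸ j) ⟨
  j + α + (β ∸ j)    ≡⟨ cong (_+ (β ∸ j)) (+-comm j α) ⟩
  α + j + (β ∸ j)    ≡⟨ +-assoc α j (β ∸ j) ⟩
  α + (j + (β ∸ j))  ≡⟨ cong (α +_) (m+[n∸m]≡n j≤β) ⟩
  α + β              ∎
  where open ≡-Reasoning

interval-shifted : ∀ j α l →
  interval 1 j ++ interval (suc j) α ++ interval (suc (j + α)) l ≡ interval 1 (j + (α + l))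
interval-shifted j α l = begin
  interval 1 j ++ interval (suc j) α ++ interval (suc (j + α)) l
    ≡⟨ cong (interval 1 j ++_) (interval-++ (suc j) α l) ⟨
  interval 1 j ++ interval (suc j) (α + l)
    ≡⟨ interval-++ 1 j (α + l) ⟨
  interval 1 (j + (α + l))
    ∎
  where open ≡-Reasoning

word132-↭ : ∀ α β j → j ≤ β → word132 α β j ↭ interval 1 (α + β)
word132-↭ α β j j≤β = begin
  H ++ L ++ R                  ↭⟨ Perm.shifts H L ⟩
  L ++ H ++ R                  ≡⟨ interval-shifted j α (β ∸ j) ⟩
  interval 1 (j + (α + (β ∸ j)))  ≡⟨ cong (interval 1) (+-∸-shuffle α j≤β) ⟩
  interval 1 (α + β)           ∎
  where
  open PermutationReasoning
  H = interval (suc j) α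
  L = interval 1 j
  R = interval (suc (j + α)) (β ∸ j)

word213-↭ : ∀ α β j → j ≤ α → word213 α β j ↭ interval 1 (α + β)
word213-↭ α β j j≤α = begin
  (L ++ R) ++ K                ≡⟨ ++-assoc L R K ⟩
  L ++ R ++ K                  ↭⟨ Perm.++⁺ˡ L (Perm.++-comm R K) ⟩
  L ++ K ++ R                  ≡⟨ interval-shifted j β (α ∸ j) ⟩
  interval 1 (j + (β + (α ∸ j)))  ≡⟨ cong (interval 1) (trans (+-∸-shuffle β j≤α) (+-comm β α)) ⟩
  interval 1 (α + β)           ∎
  where
  open PermutationReasoning
  L = interval 1 j
  R = interval (suc (j + β)) (α ∸ j)
  K = interval (suc j) β

word132-separated : ∀ α β j {k} → k ∈ interval 1 j ++ interval (suc (j + α)) (β ∸ j) →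
                    Separated k (interval (suc j) α)
word132-separated α β j k∈ with ∈.∈-++⁻ (interval 1 j) k∈
... | inj₁ k∈L = inj₂ (All.tabulate λ h∈ →
  <-≤-trans (proj₂ (∈-interval⁻ 1 j k∈L)) (proj₁ (∈-interval⁻ (suc j) α h∈)))
... | inj₂ k∈R = inj₁ (All.tabulate λ h∈ →
  <-≤-trans (proj₂ (∈-interval⁻ (suc j) α h∈)) (proj₁ (∈-interval⁻ _ _ k∈R)))

word213-separated : ∀ α β j {h} → h ∈ interval 1 j ++ interval (suc (j + β)) (α ∸ j) →
                    Separated h (interval (suc j) β)
word213-separated α β j h∈ with ∈.∈-++⁻ (interval 1 j) h∈
... | inj₁ h∈L = inj₂ (All.tabulate λ k∈ →
  <-≤-trans (proj₂ (∈-interval⁻ 1 j h∈L)) (proj₁ (∈-interval⁻ (suc j) β k∈)))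
... | inj₂ h∈R = inj₁ (All.tabulate λ k∈ →
  <-≤-trans (proj₂ (∈-interval⁻ (suc j) β k∈)) (proj₁ (∈-interval⁻ _ _ h∈R)))

interval-isReading : ∀ m d P → Avoids (interval 1 ((2 + m) * d)) P →
                     IsReading (2 + m) d P (interval 1 ((2 + m) * d))
interval-isReading m d P = twoRuns-isReading m 0 d P [] (interval-increasing 1 _)
  (sym (*-zeroʳ (2 + m))) (length-interval 1 _) ↭-refl

word132-isReading : ∀ m a p j → j ≤ (2 + m) * p →
  IsReading (2 + m) (a + p) (p132 ∷ p321 ∷ []) (word132 ((2 + m) * a) ((2 + m) * p) j)
word132-isReading m a p j j≤β =
  twoRuns-isReading m a p _ iH iK (length-interval (suc j) α) (length-intervals 1 _ j≤β)
    (subst (λ n → word132 α β j ↭ interval 1 n) (sym (*-distribˡ-+ (2 + m) a p)) (word132-↭ α β j j≤β))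
    (twoRuns-avoid-132 iH iK (word132-separated α β j) ∷ twoRuns-avoid-321 iH iK ∷ [])
  where
  α = (2 + m) * a
  β = (2 + m) * p
  iH = interval-increasing (suc j) α
  iK = intervals-increasing (β ∸ j) (s≤s (m≤m+n j α))

word213-isReading : ∀ m a p j → j ≤ (2 + m) * a →
  IsReading (2 + m) (a + p) (p213 ∷ p321 ∷ []) (word213 ((2 + m) * a) ((2 + m) * p) j)
word213-isReading m a p j j≤α =
  twoRuns-isReading m a p _ iH iK (length-intervals 1 _ j≤α) (length-interval (suc j) β)
    (subst (λ n → word213 α β j ↭ interval 1 n) (sym (*-distribˡ-+ (2 + m) a p)) (word213-↭ α β j j≤α))
    (twoRuns-avoid-213 iH iK (word213-separated α β j) ∷ twoRuns-avoid-321 iH iK ∷ [])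
  where
  α = (2 + m) * a
  β = (2 + m) * p
  iH = intervals-increasing (α ∸ j) (s≤s (m≤m+n j β))
  iK = interval-increasing (suc j) β

-- Avoiders read as two increasing runs

ForcesIncreasingMiddles : List ℕ → Set
ForcesIncreasingMiddles p =
  ∀ {b ms t} → All (λ x → b < x × x < t) ms → ¬ Contains (b ∷ ms ++ [ t ]) p → Increasing ms

middles-increasing-132 : ForcesIncreasingMiddles p132
middles-increasing-132 {b} {ms} {t} bounds avoids = increasing-fromPairs ms λ {u} {w} τ →
  decidable-stable (u <? w) λ u≮w → avoids (contains-132 (refl ∷ ++⁺ʳ [ t ] τ)
    (proj₁ (All.lookup bounds (to∈ τ))) (proj₁ (All.lookup bounds (to∈ (∷ˡ⁻ τ)))) u≮w)

middles-increasing-213 : ForcesIncreasingMiddles p213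
middles-increasing-213 {b} {ms} {t} bounds avoids = increasing-fromPairs ms λ {u} {w} τ →
  decidable-stable (u <? w) λ u≮w → avoids (contains-213 (b ∷ʳ ++⁺ τ (refl ∷ []))
    u≮w (proj₂ (All.lookup bounds (to∈ τ))) (proj₂ (All.lookup bounds (to∈ (∷ˡ⁻ τ)))))

reading-increasing : ∀ {b x ms t} → All (λ y → b < y × y < t) (x ∷ ms) → Increasing (x ∷ ms) →
                     Increasing (readDiamond (b , x ∷ ms , t))
reading-increasing {b} {x} {ms} {t} bounds@((b<x , x<t) ∷ _) ims =
  All.++⁺ (All.map proj₁ bounds) (<-trans b<x x<t ∷ []) ∷
  increasing-++⁺ ims ([] ∷ []) λ { y∈ (here refl) → proj₂ (All.lookup bounds y∈) }

diamonds-increasing : ∀ {m p} → ForcesIncreasingMiddles p →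
  ∀ D → All (WellLabelled (3 + m)) D → ¬ Contains (perm D) p → All (Increasing ∘ readDiamond) D
diamonds-increasing middles []                       []                   _      = []
diamonds-increasing middles ((b , []     , t) ∷ D) ((() , _) ∷ _)        _
diamonds-increasing middles ((b , x ∷ ms , t) ∷ D) ((_ , bounds) ∷ wl) avoids =
  reading-increasing bounds (middles bounds (avoids-⊆ (++⁺ʳ (perm D) ⊆-refl) avoids)) ∷
  diamonds-increasing middles D wl (avoids-⊆ (++⁺ˡ (readDiamond (b , x ∷ ms , t)) ⊆-refl) avoids)

record DescentAcross (R P : List ℕ) : Set where
  constructor descentAcross
  field
    {peak next} : ℕ
    {rest}      : List ℕ
    peak∈       : peak ∈ R
    P≡          : P ≡ next ∷ rest
    peak≮next   : peak ≮ next

increasing-++-or-descent : ∀ R {P} → Increasing R → Increasing P → Increasing (R ++ P) ⊎ DescentAcross R P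
increasing-++-or-descent R {[]}    iR _                 = inj₁ (subst Increasing (sym (++-identityʳ R)) iR)
increasing-++-or-descent R {y ∷ P} iR iP@(y< ∷ _) with All.all? (_<? y) R
... | yes R<y = inj₁ (increasing-++⁺ iR iP λ
        { x∈ (here refl) → All.lookup R<y x∈ ; x∈ (there z∈) → <-trans (All.lookup R<y x∈) (All.lookup y< z∈) })
... | no ¬R<y with find (All.¬All⇒Any¬ (_<? y) R ¬R<y)
...   | x , x∈ , x≮y = inj₂ (descentAcross x∈ refl x≮y)

record Descent {X : Set} (f : X → List ℕ) (xs : List X) : Set where
  constructor descent
  field
    before after : List X
    split        : xs ≡ before ++ after
    increasing   : Increasing (concatMap f before)
    across       : DescentAcross (concatMap f before) (concatMap f after)

descentAcross-++ˡ : ∀ L {R P} → DescentAcross R P → DescentAcross (L ++ R) P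
descentAcross-++ˡ L (descentAcross p∈ P≡ p≮n) = descentAcross (∈.∈-++⁺ʳ L p∈) P≡ p≮n

descentAcross-++ʳ : ∀ {R P} Q → DescentAcross R P → DescentAcross R (P ++ Q)
descentAcross-++ʳ Q (descentAcross p∈ P≡ p≮n) = descentAcross p∈ (cong (_++ Q) P≡) p≮n

descent-∷ : ∀ {X} (f : X → List ℕ) x xs → Increasing (f x) → DescentAcross (f x) (concatMap f xs) →
            Descent f (x ∷ xs)
descent-∷ f x xs ix d =
  descent [ x ] xs refl (subst Increasing f[x]≡ ix) (subst (λ R → DescentAcross R _) f[x]≡ d)
  where
  f[x]≡ : f x ≡ concatMap f [ x ]
  f[x]≡ = sym (++-identityʳ (f x))

increasing-or-descent : ∀ {X} (f : X → List ℕ) xs → All (Increasing ∘ f) xs →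
                        Increasing (concatMap f xs) ⊎ Descent f xs
increasing-or-descent f []       []          = inj₁ []
increasing-or-descent f (x ∷ xs) (ix ∷ ixs) with increasing-or-descent f xs ixs
... | inj₁ i with increasing-++-or-descent (f x) ix i
...   | inj₁ i′ = inj₁ i′
...   | inj₂ d  = inj₂ (descent-∷ f x xs ix d)
increasing-or-descent f (x ∷ xs) (ix ∷ ixs) | inj₂ (descent b a refl ib d)
  with increasing-++-or-descent (f x) ix ib
... | inj₁ i′ = inj₂ (descent (x ∷ b) a refl i′ (descentAcross-++ˡ (f x) d))
... | inj₂ d′ = inj₂ (descent-∷ f x (b ++ a) ix (subst (DescentAcross (f x)) (sym (concatMap-++ f b a))
                                                       (descentAcross-++ʳ (concatMap f a) d′)))

≮-trans : ∀ {a b c} → a ≮ b → b ≮ c → a ≮ c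
≮-trans a≮b b≮c = ≤⇒≯ (≤-trans (≮⇒≥ b≮c) (≮⇒≥ a≮b))

-- After a descent x > y, avoiding 321 leaves as the only possible inversions u > w later on
-- those with y < w; the second pattern (132 or 213) has to exclude them.
increasing-after-descent : ∀ {A y B x} → x ∈ A → x ≮ y → ¬ Contains (A ++ y ∷ B) p321 →
  (∀ {u w} → u ∷ w ∷ [] ⊆ B → u ≮ w → y < w → ⊥) → Increasing (y ∷ B)
increasing-after-descent {A} {y} {B} {x} x∈ x≮y ¬321 no-inversion = increasing-fromPairs (y ∷ B) pair<
  where
  pair< : ∀ {u w} → u ∷ w ∷ [] ⊆ y ∷ B → u < w
  pair< {u} {w} τ = decidable-stable (u <? w) λ u≮w → inversion τ u≮w
    where
    above-y : ∀ {w} → w ∷ [] ⊆ B → y ≮ w → ⊥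
    above-y τ′ y≮w = ¬321 (contains-321 (++⁺ (from∈ x∈) (refl ∷ τ′)) x≮y (≮-trans x≮y y≮w) y≮w)
    inversion : u ∷ w ∷ [] ⊆ y ∷ B → u ≮ w → ⊥
    inversion (refl ∷ τ′) y≮w = above-y τ′ y≮w
    inversion (_ ∷ʳ τ′)  u≮w with y <? w
    ... | yes y<w = no-inversion τ′ u≮w y<w
    ... | no y≮w  = above-y (∷ˡ⁻ τ′) y≮w

increasing-after-descent-132 : ∀ {A y B x} → x ∈ A → x ≮ y →
  ¬ Contains (A ++ y ∷ B) p132 → ¬ Contains (A ++ y ∷ B) p321 → Increasing (y ∷ B)
increasing-after-descent-132 {A} {y} {B} x∈ x≮y ¬132 ¬321 = increasing-after-descent x∈ x≮y ¬321 inversion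
  where
  inversion : ∀ {u w} → u ∷ w ∷ [] ⊆ B → u ≮ w → y < w → ⊥
  inversion {u} τ u≮w y<w with y <? u
  ... | yes y<u = ¬132 (contains-132 (++⁺ˡ A (refl ∷ τ)) y<u y<w u≮w)
  ... | no y≮u  = ¬321 (contains-321 (++⁺ˡ A (refl ∷ τ)) y≮u (≮-trans y≮u u≮w) u≮w)

increasing-after-descent-213 : ∀ {A y B x} → x ∈ A → x ≮ y →
  ¬ Contains (A ++ y ∷ B) p213 → ¬ Contains (A ++ y ∷ B) p321 → Increasing (y ∷ B)
increasing-after-descent-213 {A} {y} {B} {x} x∈ x≮y ¬213 ¬321 = increasing-after-descent x∈ x≮y ¬321 inversion
  where
  inversion : ∀ {u w} → u ∷ w ∷ [] ⊆ B → u ≮ w → y < w → ⊥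
  inversion {u} τ u≮w y<w with x <? u
  ... | yes x<u =
    ¬213 (contains-213 (++⁺ (from∈ x∈) (refl ∷ from∈ (to∈ τ))) x≮y x<u (<-≤-trans y<w (≮⇒≥ u≮w)))
  ... | no x≮u  = ¬321 (contains-321 (++⁺ (from∈ x∈) (y ∷ʳ τ)) x≮u (≮-trans x≮u u≮w) u≮w)

interval-unique : ∀ s l → Unique (interval s l)
interval-unique s l = AllPairs.map <⇒≢ (interval-increasing s l)

unique-of-↭-interval : ∀ {xs s l} → xs ↭ interval s l → Unique xs
unique-of-↭-interval {s = s} {l} p =
  PermSetoid.Unique-resp-↭ (setoid ℕ) (↭⇒↭ₛ (↭-sym p)) (interval-unique s l)

head-≤ : ∀ {h H a} → Increasing (h ∷ H) → a ∈ h ∷ H → h ≤ a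
head-≤ _        (here refl) = ≤-refl
head-≤ (h< ∷ _) (there a∈)  = <⇒≤ (All.lookup h< a∈)

split-at : ∀ h {K} → Increasing K →
  Σ (List ℕ) λ Kl → Σ (List ℕ) λ Kh → K ≡ Kl ++ Kh × All (_< h) Kl × All (_≮ h) Kh
split-at h {[]}    _          = [] , [] , refl , [] , []
split-at h {k ∷ K} (k< ∷ iK) with k <? h
... | no k≮h  = [] , k ∷ K , refl , [] , k≮h ∷ All.map (λ k<k′ k′<h → k≮h (<-trans k<k′ k′<h)) k<
... | yes k<h with split-at h iK
...   | Kl , Kh , refl , Kl<h , Kh≮h = k ∷ Kl , Kh , refl , k<h ∷ Kl<h , Kh≮h

sandwich-132 : ∀ H Kl Kh {n} → Increasing H → Increasing (Kl ++ Kh) →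
  (∀ {k h} → k ∈ Kl → h ∈ H → k < h) → (∀ {h k} → h ∈ H → k ∈ Kh → h < k) →
  H ++ Kl ++ Kh ↭ interval 1 n → H ++ Kl ++ Kh ≡ word132 (length H) (length (Kl ++ Kh)) (length Kl)
sandwich-132 H Kl Kh iH iK Kl<H H<Kh ↭I with increasing-++⁻ Kl iK
... | iKl , iKh , Kl<Kh with increasing-↭-interval Kl H Kh σ-increasing (↭-trans (Perm.shifts Kl H) ↭I)
  where
  σ-increasing : Increasing (Kl ++ H ++ Kh)
  σ-increasing = increasing-++⁺ iKl (increasing-++⁺ iH iKh H<Kh)
    λ k∈ c∈ → Sum.[ Kl<H k∈ , Kl<Kh k∈ ] (∈.∈-++⁻ H c∈)
...   | eKl , eH , eKh = cong₂ _++_ eH (cong₂ _++_ eKl (trans eKh (cong (interval _) |Kh|≡)))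
  where
  |Kh|≡ : length Kh ≡ length (Kl ++ Kh) ∸ length Kl
  |Kh|≡ = sym (trans (cong (_∸ length Kl) (length-++ Kl)) (m+n∸m≡n (length Kl) (length Kh)))

sandwich-213 : ∀ Hl Hh K {n} → Increasing (Hl ++ Hh) → Increasing K →
  (∀ {h k} → h ∈ Hl → k ∈ K → h < k) → (∀ {k h} → k ∈ K → h ∈ Hh → k < h) →
  (Hl ++ Hh) ++ K ↭ interval 1 n → (Hl ++ Hh) ++ K ≡ word213 (length (Hl ++ Hh)) (length K) (length Hl)
sandwich-213 Hl Hh K iH iK Hl<K K<Hh ↭I with increasing-++⁻ Hl iH
... | iHl , iHh , Hl<Hh with increasing-↭-interval Hl K Hh σ-increasing (↭-trans (↭-sym reorder) ↭I)
  where
  σ-increasing : Increasing (Hl ++ K ++ Hh)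
  σ-increasing = increasing-++⁺ iHl (increasing-++⁺ iK iHh K<Hh)
    λ h∈ c∈ → Sum.[ Hl<K h∈ , Hl<Hh h∈ ] (∈.∈-++⁻ K c∈)
  reorder : (Hl ++ Hh) ++ K ↭ Hl ++ K ++ Hh
  reorder = subst (_↭ Hl ++ K ++ Hh) (sym (++-assoc Hl Hh K)) (Perm.++⁺ˡ Hl (Perm.++-comm Hh K))
...   | eHl , eK , eHh = cong₂ _++_ (cong₂ _++_ eHl (trans eHh (cong (interval _) |Hh|≡))) eK
  where
  |Hh|≡ : length Hh ≡ length (Hl ++ Hh) ∸ length Hl
  |Hh|≡ = sym (trans (cong (_∸ length Hl) (length-++ Hl)) (m+n∸m≡n (length Hl) (length Hh)))

<-of-≮-≢ : ∀ {a b} → b ≮ a → a ≢ b → a < b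
<-of-≮-≢ b≮a a≢b = ≤∧≢⇒< (≮⇒≥ b≮a) a≢b

-- The elements of K below the head h of H come first, and every later one exceeds all of H,
-- since otherwise h, a, k would form a 132.
twoRuns-132-shape : ∀ {H K n} → Increasing H → Increasing K → H ++ K ↭ interval 1 n →
  ¬ Contains (H ++ K) p132 → DescentAcross H K →
  Σ ℕ λ j → 1 ≤ j × j ≤ length K × H ++ K ≡ word132 (length H) (length K) j
twoRuns-132-shape {h ∷ H′} {K} iH@(h< ∷ _) iK ↭I ¬132 (descentAcross {next = y} x∈ K≡ x≮y)
  with split-at h iK
... | Kl , Kh , refl , Kl<h , Kh≮h =
  length Kl , ∈.∈-length y∈Kl , length-++-≤ˡ Kl ,
  sandwich-132 (h ∷ H′) Kl Kh iH iK (λ k∈ a∈ → <-≤-trans (All.lookup Kl<h k∈) (head-≤ iH a∈)) H<Kh ↭I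
  where
  above : ∀ {k} → k ∈ Kl ++ Kh → k ≮ h → All (_< k) (h ∷ H′)
  above {k} k∈ k≮h = h<k ∷ All.tabulate λ {a} a∈ → decidable-stable (a <? k) λ a≮k →
      ¬132 (contains-132 (refl ∷ ++⁺ (from∈ a∈) (from∈ k∈)) (All.lookup h< a∈) h<k a≮k)
    where
    h<k = <-of-≮-≢ k≮h (AllPairs-pair (refl ∷ ++⁺ˡ H′ (from∈ k∈)) (unique-of-↭-interval ↭I))
  H<Kh : ∀ {a k} → a ∈ h ∷ H′ → k ∈ Kh → a < k
  H<Kh a∈ k∈ = All.lookup (above (∈.∈-++⁺ʳ Kl k∈) (All.lookup Kh≮h k∈)) a∈
  y∈Kl : y ∈ Kl
  y∈Kl with ∈.∈-++⁻ Kl (subst (y ∈_) (sym K≡) (here refl))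
  ... | inj₁ y∈Kl = y∈Kl
  ... | inj₂ y∈Kh = ⊥-elim (x≮y (H<Kh x∈ y∈Kh))

-- Dually, the elements of H below the head y of K come first, and every later one exceeds
-- all of K, since otherwise a, y, k would form a 213.
twoRuns-213-shape : ∀ {H K n} → Increasing H → Increasing K → H ++ K ↭ interval 1 n →
  ¬ Contains (H ++ K) p213 → DescentAcross H K →
  Σ ℕ λ j → j < length H × H ++ K ≡ word213 (length H) (length K) j
twoRuns-213-shape {H} {y ∷ K′} iH iK@(y< ∷ _) ↭I ¬213 (descentAcross {peak = x} x∈ refl x≮y)
  with split-at y iH
... | Hl , Hh , refl , Hl<y , Hh≮y =
  length Hl , j<|H| ,
  sandwich-213 Hl Hh (y ∷ K′) iH iK (λ h∈ k∈ → <-≤-trans (All.lookup Hl<y h∈) (head-≤ iK k∈)) K<Hh ↭I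
  where
  below : ∀ {a} → a ∈ Hl ++ Hh → a ≮ y → All (_< a) (y ∷ K′)
  below {a} a∈ a≮y = y<a ∷ All.tabulate λ {k} k∈ → decidable-stable (k <? a) λ k≮a →
      ¬213 (contains-213 (++⁺ (from∈ a∈) (refl ∷ from∈ k∈)) a≮y
              (<-of-≮-≢ k≮a (distinct (there k∈))) (All.lookup y< k∈))
    where
    distinct : ∀ {k} → k ∈ y ∷ K′ → a ≢ k
    distinct k∈ = AllPairs-pair (++⁺ (from∈ a∈) (from∈ k∈)) (unique-of-↭-interval ↭I)
    y<a = <-of-≮-≢ a≮y (≢-sym (distinct (here refl)))
  K<Hh : ∀ {k a} → k ∈ y ∷ K′ → a ∈ Hh → k < a
  K<Hh k∈ a∈ = All.lookup (below (∈.∈-++⁺ʳ Hl a∈) (All.lookup Hh≮y a∈)) k∈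
  j<|H| : length Hl < length (Hl ++ Hh)
  j<|H| with ∈.∈-++⁻ Hl x∈
  ... | inj₁ x∈Hl = ⊥-elim (x≮y (All.lookup Hl<y x∈Hl))
  ... | inj₂ x∈Hh = subst (length Hl <_) (sym (length-++ Hl)) (m<m+n (length Hl) (∈.∈-length x∈Hh))

-- Counting the reading words

dependentPairs : (ℕ → List ℕ) → List ℕ → List (ℕ × ℕ)
dependentPairs G = concatMap (λ p → map (p ,_) (G p))

∈-dependentPairs⁺ : ∀ {G ps p j} → p ∈ ps → j ∈ G p → (p , j) ∈ dependentPairs G ps
∈-dependentPairs⁺ {G} p∈ j∈ = ∈.∈-concat⁺′ (∈.∈-map⁺ _ j∈) (∈.∈-map⁺ (λ p → map (p ,_) (G p)) p∈)

∈-dependentPairs⁻ : ∀ {G} ps {p j} → (p , j) ∈ dependentPairs G ps → p ∈ ps × j ∈ G p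
∈-dependentPairs⁻ {G} ps q∈ with ∈.∈-concat⁻′ (map (λ p → map (p ,_) (G p)) ps) q∈
... | _ , q∈′ , group∈ with ∈.∈-map⁻ (λ p → map (p ,_) (G p)) group∈
...   | p , p∈ , refl with ∈.∈-map⁻ (p ,_) q∈′
...     | j , j∈ , refl = p∈ , j∈

unique-dependentPairs : ∀ G {ps} → Unique ps → (∀ p → Unique (G p)) → Unique (dependentPairs G ps)
unique-dependentPairs G {ps} unique-ps unique-G =
  Unique.concat⁺ (All.map⁺ (All.tabulate λ {p} _ → Unique.map⁺ (cong proj₂) (unique-G p)))
                 (AllPairs.map⁺ (AllPairs.map disjoint unique-ps))
  where
  disjoint : ∀ {p q} → p ≢ q → ∀ {x} → ¬ (x ∈ map (p ,_) (G p) × x ∈ map (q ,_) (G q))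
  disjoint p≢q (x∈p , x∈q) with ∈.∈-map⁻ _ x∈p | ∈.∈-map⁻ _ x∈q
  ... | _ , _ , refl | _ , _ , e = p≢q (cong proj₁ e)

length-dependentPairs-interval : ∀ v s ps →
  length (dependentPairs (λ p → interval s (v * p)) ps) ≡ v * sum ps
length-dependentPairs-interval v s []       = sym (*-zeroʳ v)
length-dependentPairs-interval v s (p ∷ ps) = begin
  length (map (p ,_) (interval s (v * p)) ++ dependentPairs _ ps)
    ≡⟨ length-++ (map (p ,_) (interval s (v * p))) ⟩
  length (map (p ,_) (interval s (v * p))) + length (dependentPairs _ ps)
    ≡⟨ cong₂ _+_ |group| (length-dependentPairs-interval v s ps) ⟩
  v * p + v * sum ps
    ≡⟨ *-distribˡ-+ v p (sum ps) ⟨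
  v * (p + sum ps)
    ∎
  where
  open ≡-Reasoning
  |group| = trans (length-map (p ,_) (interval s (v * p))) (length-interval s (v * p))

sum-interval : ∀ m → sum (interval 1 m) * 2 ≡ suc m * m
sum-interval zero    = refl
sum-interval (suc m) = begin
  sum (interval 1 (suc m)) * 2                 ≡⟨ cong (λ l → sum (interval 1 l) * 2) (+-comm 1 m) ⟩
  sum (interval 1 (m + 1)) * 2                 ≡⟨ cong (λ xs → sum xs * 2) (interval-++ 1 m 1) ⟩
  sum (interval 1 m ++ [ suc m ]) * 2          ≡⟨ cong (_* 2) (sum-++ (interval 1 m) [ suc m ]) ⟩
  (sum (interval 1 m) + (suc m + 0)) * 2       ≡⟨ *-distribʳ-+ 2 (sum (interval 1 m)) (suc m + 0) ⟩
  sum (interval 1 m) * 2 + (suc m + 0) * 2     ≡⟨ cong (_+ (suc m + 0) * 2) (sum-interval m) ⟩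
  suc m * m + (suc m + 0) * 2                  ≡⟨ gauss-step m ⟩
  suc (suc m) * suc m                          ∎
  where
  open ≡-Reasoning
  gauss-step : ∀ m → suc m * m + (suc m + 0) * 2 ≡ suc (suc m) * suc m
  gauss-step = solve-∀

triangle≡sum : ∀ d → 1 ≤ d → d * (d ∸ 1) / 2 ≡ sum (interval 1 (d ∸ 1))
triangle≡sum (suc m) _ =
  trans (cong (_/ 2) (sym (sum-interval m))) (m*n/n≡m (sum (interval 1 m)) 2)

blockPairs : ℕ → ℕ → ℕ → List (ℕ × ℕ)
blockPairs v d s = dependentPairs (λ p → interval s (v * p)) (interval 1 (d ∸ 1))

length-blockPairs : ∀ v d s → 1 ≤ d → length (blockPairs v d s) ≡ v * (d * (d ∸ 1) / 2)
length-blockPairs v d s 1≤d =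
  trans (length-dependentPairs-interval v s (interval 1 (d ∸ 1))) (cong (v *_) (sym (triangle≡sum d 1≤d)))

unique-blockPairs : ∀ v d s → Unique (blockPairs v d s)
unique-blockPairs v d s = unique-dependentPairs _ (interval-unique 1 (d ∸ 1)) (λ p → interval-unique s (v * p))

positive-<-pred : ∀ {p} d → 1 ≤ p → p < suc (d ∸ 1) → p < d
positive-<-pred zero    1≤p p<1 = ⊥-elim (<⇒≱ p<1 1≤p)
positive-<-pred (suc d) _   p<  = p<

∈-blockPairs⁻ : ∀ v d s {p j} → (p , j) ∈ blockPairs v d s → 1 ≤ p × p < d × s ≤ j × j < s + v * p
∈-blockPairs⁻ v d s {p} {j} q∈ with ∈-dependentPairs⁻ (interval 1 (d ∸ 1)) q∈
... | p∈ , j∈ with ∈-interval⁻ 1 (d ∸ 1) p∈ | ∈-interval⁻ s (v * p) j∈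
...   | 1≤p , p<1+[d∸1] | s≤j , j<s+vp = 1≤p , positive-<-pred d 1≤p p<1+[d∸1] , s≤j , j<s+vp

∈-blockPairs⁺ : ∀ v d s {p j} → 1 ≤ p → p < d → s ≤ j → j < s + v * p → (p , j) ∈ blockPairs v d s
∈-blockPairs⁺ v (suc d) s 1≤p (s≤s p≤d) s≤j j< =
  ∈-dependentPairs⁺ (∈-interval⁺ 1 d 1≤p (s≤s p≤d)) (∈-interval⁺ _ _ s≤j j<)

word132At : ℕ → ℕ → ℕ × ℕ → List ℕ
word132At v d (p , j) = word132 (v * (d ∸ p)) (v * p) j

readings132 : ℕ → ℕ → List (List ℕ)
readings132 v d = interval 1 (v * d) ∷ map (word132At v d) (blockPairs v d 1)

word213At : ℕ → ℕ → ℕ × ℕ → List ℕ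
word213At v d (a , j) = word213 (v * a) (v * (d ∸ a)) j

readings213 : ℕ → ℕ → List (List ℕ)
readings213 v d = interval 1 (v * d) ∷ map (word213At v d) (blockPairs v d 0)

-- A word of either family is determined by the length α of its first increasing run together
-- with the entry j + 1: its first entry for 132, the entry right after the run for 213.
ascentFrom : ℕ → List ℕ → ℕ
ascentFrom x []       = 0
ascentFrom x (y ∷ ys) with x <? y
... | yes _ = suc (ascentFrom y ys)
... | no  _ = 0

ascent : List ℕ → ℕ
ascent []       = 0
ascent (x ∷ xs) = suc (ascentFrom x xs)

entryAfterAscent : List ℕ → Maybe ℕ
entryAfterAscent w = head (drop (ascent w) w)

ascentFrom-increasing : ∀ x ys → Increasing (x ∷ ys) → ascentFrom x ys ≡ length ys
ascentFrom-increasing x []       _                 = refl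
ascentFrom-increasing x (y ∷ ys) ((x<y ∷ _) ∷ iys) with x <? y
... | yes _  = cong suc (ascentFrom-increasing y ys iys)
... | no x≮y = ⊥-elim (x≮y x<y)

ascent-increasing : ∀ {xs} → Increasing xs → ascent xs ≡ length xs
ascent-increasing {[]}     _ = refl
ascent-increasing {x ∷ xs} i = cong suc (ascentFrom-increasing x xs i)

ascentFrom-++ : ∀ a A {t r z} → Increasing (a ∷ A) → z ∈ a ∷ A → t ≤ z →
                ascentFrom a (A ++ t ∷ r) ≡ length A
ascentFrom-++ a []      {t} _ (here refl) t≤a with a <? t
... | yes a<t = ⊥-elim (<⇒≱ a<t t≤a)
... | no _    = refl
ascentFrom-++ a (b ∷ A) ((a<b ∷ _) ∷ i) z∈ t≤z with a <? b
... | no a≮b = ⊥-elim (a≮b a<b)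
... | yes _ with z∈
...   | here refl = cong suc (ascentFrom-++ b A i (here refl) (≤-trans t≤z (<⇒≤ a<b)))
...   | there z∈′ = cong suc (ascentFrom-++ b A i z∈′ t≤z)

ascent-++ : ∀ {A t r z} → Increasing A → z ∈ A → t ≤ z → ascent (A ++ t ∷ r) ≡ length A
ascent-++ {a ∷ A} i z∈ t≤z = cong suc (ascentFrom-++ a A i z∈ t≤z)

ascent-word132 : ∀ α β j → 1 ≤ α → 1 ≤ j → ascent (word132 α β j) ≡ α
ascent-word132 α β (suc j) 1≤α _ =
  trans (ascent-++ (interval-increasing (suc (suc j)) α) (∈-interval⁺ _ α ≤-refl (m<m+n _ 1≤α)) (s≤s z≤n))
        (length-interval _ α)

head-word132 : ∀ α β j → 1 ≤ α → head (word132 α β j) ≡ just (suc j)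
head-word132 (suc α) β j _ = refl

ascent-word213 : ∀ α β j → j < α → 1 ≤ β → ascent (word213 α β j) ≡ α
ascent-word213 α (suc β) j j<α _ =
  trans (ascent-++ (intervals-increasing (α ∸ j) (s≤s (m≤m+n j (suc β))))
          (∈.∈-++⁺ʳ (interval 1 j) (∈-interval⁺ _ (α ∸ j) ≤-refl (m<m+n _ (m<n⇒0<n∸m j<α))))
          (s≤s (m≤m+n j (suc β))))
        (length-intervals 1 _ (<⇒≤ j<α))

head-drop-word213 : ∀ α β j → j ≤ α → 1 ≤ β → head (drop α (word213 α β j)) ≡ just (suc j)
head-drop-word213 α (suc β) j j≤α _ =
  cong head (trans (cong (λ n → drop n (word213 α (suc β) j)) (sym (length-intervals 1 _ j≤α)))
                   (drop-length-++ (interval 1 j ++ interval (suc (j + suc β)) (α ∸ j)) _))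

unique-map⁺-on : ∀ {A B : Set} (f : A → B) {xs} → Unique xs →
  (∀ {a b} → a ∈ xs → b ∈ xs → f a ≡ f b → a ≡ b) → Unique (map f xs)
unique-map⁺-on f []          _   = []
unique-map⁺-on f (x∉ ∷ uxs) inj =
  All.tabulate (λ fy∈ fx≡ → fresh fy∈ fx≡) ∷ unique-map⁺-on f uxs (λ a∈ b∈ → inj (there a∈) (there b∈))
  where
  fresh : ∀ {b} → b ∈ map f _ → f _ ≡ b → ⊥
  fresh fy∈ fx≡ with ∈.∈-map⁻ f fy∈
  ... | y , y∈ , refl = All.lookup x∉ y∈ (inj (here refl) (there y∈) fx≡)

ascent-interval : ∀ s l → ascent (interval s l) ≡ l
ascent-interval s l = trans (ascent-increasing (interval-increasing s l)) (length-interval s l)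

1≤*-positive : ∀ m {a} → 1 ≤ a → 1 ≤ (2 + m) * a
1≤*-positive m = *-mono-≤ {1} {2 + m} (s≤s z≤n)

unique-readings132 : ∀ m d → Unique (readings132 (2 + m) d)
unique-readings132 m d =
  All.tabulate identity≢ ∷ unique-map⁺-on (word132At v d) (unique-blockPairs v d 1) injective
  where
  v = 2 + m
  decode : ∀ {p j} → (p , j) ∈ blockPairs v d 1 →
    p < d × ascent (word132At v d (p , j)) ≡ v * (d ∸ p) × head (word132At v d (p , j)) ≡ just (suc j)
  decode {p} {j} q∈ with ∈-blockPairs⁻ v d 1 q∈
  ... | _ , p<d , 1≤j , _ = p<d , ascent-word132 _ _ j 1≤α 1≤j , head-word132 _ _ j 1≤α
    where 1≤α = 1≤*-positive m (m<n⇒0<n∸m p<d)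
  identity≢ : ∀ {w} → w ∈ map (word132At v d) (blockPairs v d 1) → interval 1 (v * d) ≢ w
  identity≢ w∈ e with ∈.∈-map⁻ (word132At v d) w∈
  ... | (p , j) , q∈ , refl with decode q∈ | ∈-blockPairs⁻ v d 1 q∈
  ...   | p<d , ascent≡ , _ | 1≤p , _ = <-irrefl (sym d≡d∸p) (∸-monoʳ-< 1≤p (<⇒≤ p<d))
    where
    d≡d∸p : d ≡ d ∸ p
    d≡d∸p = *-cancelˡ-≡ d (d ∸ p) v (trans (sym (ascent-interval 1 (v * d))) (trans (cong ascent e) ascent≡))
  injective : ∀ {q q′} → q ∈ blockPairs v d 1 → q′ ∈ blockPairs v d 1 →
              word132At v d q ≡ word132At v d q′ → q ≡ q′
  injective {p , j} {p′ , j′} q∈ q′∈ e with decode q∈ | decode q′∈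
  ... | p<d , ascent≡ , head≡ | p′<d , ascent≡′ , head≡′ = cong₂ _,_ p≡p′ j≡j′
    where
    d∸p≡ : d ∸ p ≡ d ∸ p′
    d∸p≡ = *-cancelˡ-≡ (d ∸ p) (d ∸ p′) v (trans (sym ascent≡) (trans (cong ascent e) ascent≡′))
    p≡p′ : p ≡ p′
    p≡p′ = trans (sym (m∸[m∸n]≡n (<⇒≤ p<d))) (trans (cong (d ∸_) d∸p≡) (m∸[m∸n]≡n (<⇒≤ p′<d)))
    j≡j′ : j ≡ j′
    j≡j′ = suc-injective (just-injective (trans (sym head≡) (trans (cong head e) head≡′)))

unique-readings213 : ∀ m d → Unique (readings213 (2 + m) d)
unique-readings213 m d =
  All.tabulate identity≢ ∷ unique-map⁺-on (word213At v d) (unique-blockPairs v d 0) injective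
  where
  v = 2 + m
  decode : ∀ {a j} → (a , j) ∈ blockPairs v d 0 →
    a < d × ascent (word213At v d (a , j)) ≡ v * a × entryAfterAscent (word213At v d (a , j)) ≡ just (suc j)
  decode {a} {j} q∈ with ∈-blockPairs⁻ v d 0 q∈
  ... | _ , a<d , _ , j<α = a<d , ascent≡ ,
    trans (cong (λ n → head (drop n (word213At v d (a , j)))) ascent≡) (head-drop-word213 _ _ j (<⇒≤ j<α) 1≤β)
    where
    1≤β = 1≤*-positive m (m<n⇒0<n∸m a<d)
    ascent≡ = ascent-word213 _ _ j j<α 1≤β
  identity≢ : ∀ {w} → w ∈ map (word213At v d) (blockPairs v d 0) → interval 1 (v * d) ≢ w
  identity≢ w∈ e with ∈.∈-map⁻ (word213At v d) w∈
  ... | (a , j) , q∈ , refl with decode q∈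
  ...   | a<d , ascent≡ , _ = <-irrefl (sym d≡a) a<d
    where
    d≡a : d ≡ a
    d≡a = *-cancelˡ-≡ d a v (trans (sym (ascent-interval 1 (v * d))) (trans (cong ascent e) ascent≡))
  injective : ∀ {q q′} → q ∈ blockPairs v d 0 → q′ ∈ blockPairs v d 0 →
              word213At v d q ≡ word213At v d q′ → q ≡ q′
  injective {a , j} {a′ , j′} q∈ q′∈ e with decode q∈ | decode q′∈
  ... | _ , ascent≡ , entry≡ | _ , ascent≡′ , entry≡′ = cong₂ _,_ a≡a′ j≡j′
    where
    a≡a′ : a ≡ a′
    a≡a′ = *-cancelˡ-≡ a a′ v (trans (sym ascent≡) (trans (cong ascent e) ascent≡′))
    j≡j′ : j ≡ j′
    j≡j′ = suc-injective (just-injective (trans (sym entry≡) (trans (cong entryAfterAscent e) entry≡′)))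

record BlockDescent (v d : ℕ) (π : List ℕ) : Set where
  constructor blockDescent
  field
    {first second} : List ℕ
    a p            : ℕ
    split          : π ≡ first ++ second
    |first|        : length first ≡ v * a
    |second|       : length second ≡ v * p
    a+p≡d          : a + p ≡ d
    increasing     : Increasing first
    across         : DescentAcross first second

blockDescent-of : ∀ m {D} → All (WellLabelled (2 + m)) D → Descent readDiamond D →
                  BlockDescent (2 + m) (length D) (perm D)
blockDescent-of m wl (descent D₁ D₂ refl iA across) with All.++⁻ D₁ wl
... | wl₁ , wl₂ = blockDescent (length D₁) (length D₂) (concatMap-++ readDiamond D₁ D₂)
                    (length-perm m D₁ wl₁) (length-perm m D₂ wl₂) (sym (length-++ D₁)) iA across

increasing-or-blockDescent : ∀ {m d p D} → ForcesIncreasingMiddles p → IsDiamondLabelling (3 + m) d D →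
  ¬ Contains (perm D) p → Increasing (perm D) ⊎ BlockDescent (3 + m) d (perm D)
increasing-or-blockDescent {m} {D = D} middles (refl , wl , _) ¬p =
  Sum.map₂ (blockDescent-of (suc m) wl)
           (increasing-or-descent readDiamond D (diamonds-increasing middles D wl ¬p))

∈-map⁺-≡ : ∀ {A B : Set} (f : A → B) {x xs y} → x ∈ xs → f x ≡ y → y ∈ map f xs
∈-map⁺-≡ f x∈ refl = ∈.∈-map⁺ f x∈

positive-factor : ∀ v {a} → 0 < v * a → 1 ≤ a
positive-factor v {zero}  0<v*0 = ⊥-elim (<-irrefl (sym (*-zeroʳ v)) 0<v*0)
positive-factor v {suc a} _     = s≤s z≤n

readings132-complete : ∀ v d {π} → π ↭ interval 1 (v * d) → ¬ Contains π p132 → ¬ Contains π p321 →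
  Increasing π ⊎ BlockDescent v d π → π ∈ readings132 v d
readings132-complete v d π↭ ¬132 ¬321 (inj₁ i) = here (increasing-↭⇒≡ i (interval-increasing 1 _) π↭)
readings132-complete v d π↭ ¬132 ¬321
  (inj₂ (blockDescent {A} a p refl |A| |B| a+p≡d iA (descentAcross {next = y} {B} x∈ refl x≮y)))
  with twoRuns-132-shape iA (increasing-after-descent-132 x∈ x≮y ¬132 ¬321) π↭ ¬132
                         (descentAcross x∈ refl x≮y)
... | j , 1≤j , j≤|B| , π≡ = there (∈-map⁺-≡ (word132At v d) q∈ (sym (trans π≡ word≡)))
  where
  1≤a = positive-factor v (subst (0 <_) |A| (∈.∈-length x∈))
  1≤p = positive-factor v (subst (0 <_) |B| z<s)
  q∈ : (p , j) ∈ blockPairs v d 1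
  q∈ = ∈-blockPairs⁺ v d 1 1≤p (subst (p <_) a+p≡d (m<n+m p 1≤a)) 1≤j (s≤s (subst (j ≤_) |B| j≤|B|))
  word≡ : word132 (length A) (length (y ∷ B)) j ≡ word132At v d (p , j)
  word≡ = cong₂ (λ α β → word132 α β j)
    (trans |A| (cong (v *_) (sym (trans (cong (_∸ p) (sym a+p≡d)) (m+n∸n≡m a p))))) |B|

readings213-complete : ∀ v d {π} → π ↭ interval 1 (v * d) → ¬ Contains π p213 → ¬ Contains π p321 →
  Increasing π ⊎ BlockDescent v d π → π ∈ readings213 v d
readings213-complete v d π↭ ¬213 ¬321 (inj₁ i) = here (increasing-↭⇒≡ i (interval-increasing 1 _) π↭)
readings213-complete v d π↭ ¬213 ¬321
  (inj₂ (blockDescent {A} a p refl |A| |B| a+p≡d iA (descentAcross {next = y} {B} x∈ refl x≮y)))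
  with twoRuns-213-shape iA (increasing-after-descent-213 x∈ x≮y ¬213 ¬321) π↭ ¬213
                         (descentAcross x∈ refl x≮y)
... | j , j<|A| , π≡ = there (∈-map⁺-≡ (word213At v d) q∈ (sym (trans π≡ word≡)))
  where
  1≤a = positive-factor v (subst (0 <_) |A| (∈.∈-length x∈))
  1≤p = positive-factor v (subst (0 <_) |B| z<s)
  q∈ : (a , j) ∈ blockPairs v d 0
  q∈ = ∈-blockPairs⁺ v d 0 1≤a (subst (a <_) a+p≡d (m<m+n a 1≤p)) z≤n (subst (j <_) |A| j<|A|)
  word≡ : word213 (length A) (length (y ∷ B)) j ≡ word213At v d (a , j)
  word≡ = cong₂ (λ α β → word213 α β j)
    |A| (trans |B| (cong (v *_) (sym (trans (cong (_∸ a) (sym a+p≡d)) (m+n∸m≡n a p)))))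

card-𝒟-132-321 : ∀ m d → 1 ≤ d →
  HasCard (𝒟 (3 + m) d (p132 ∷ p321 ∷ [])) (1 + (3 + m) * (d * (d ∸ 1) / 2))
card-𝒟-132-321 m d 1≤d =
  subst (HasCard _) (cong suc (trans (length-map _ (blockPairs v d 1)) (length-blockPairs v d 1 1≤d)))
    (hasCard-of-readings (suc m) d _ (readings132 v d) (unique-readings132 (suc m) d) sound complete)
  where
  v = 3 + m
  sound : ∀ {w} → w ∈ readings132 v d → IsReading v d (p132 ∷ p321 ∷ []) w
  sound (here refl) =
    interval-isReading (suc m) d _ (twoRuns-avoid-132 [] i (λ _ → inj₁ []) ∷ twoRuns-avoid-321 [] i ∷ [])
    where i = interval-increasing 1 (v * d)
  sound (there w∈) with ∈.∈-map⁻ (word132At v d) w∈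
  ... | (p , j) , q∈ , refl with ∈-blockPairs⁻ v d 1 q∈
  ...   | _ , p<d , _ , j<1+vp =
    subst (λ d′ → IsReading v d′ _ (word132At v d (p , j))) (m∸n+n≡m (<⇒≤ p<d))
          (word132-isReading (suc m) (d ∸ p) p j (≤-pred j<1+vp))
  complete : ∀ {D} → 𝒟 v d (p132 ∷ p321 ∷ []) D → perm D ∈ readings132 v d
  complete {D} (D∈@(_ , _ , labels) , ¬132 ∷ ¬321 ∷ []) =
    readings132-complete v d (subst (perm D ↭_) (oneTo≡interval _) labels) ¬132 ¬321
      (increasing-or-blockDescent middles-increasing-132 D∈ ¬132)

card-𝒟-213-321 : ∀ m d → 1 ≤ d →
  HasCard (𝒟 (3 + m) d (p213 ∷ p321 ∷ [])) (1 + (3 + m) * (d * (d ∸ 1) / 2))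
card-𝒟-213-321 m d 1≤d =
  subst (HasCard _) (cong suc (trans (length-map _ (blockPairs v d 0)) (length-blockPairs v d 0 1≤d)))
    (hasCard-of-readings (suc m) d _ (readings213 v d) (unique-readings213 (suc m) d) sound complete)
  where
  v = 3 + m
  sound : ∀ {w} → w ∈ readings213 v d → IsReading v d (p213 ∷ p321 ∷ []) w
  sound (here refl) =
    interval-isReading (suc m) d _ (twoRuns-avoid-213 [] i (λ ()) ∷ twoRuns-avoid-321 [] i ∷ [])
    where i = interval-increasing 1 (v * d)
  sound (there w∈) with ∈.∈-map⁻ (word213At v d) w∈
  ... | (a , j) , q∈ , refl with ∈-blockPairs⁻ v d 0 q∈
  ...   | _ , a<d , _ , j<va =
    subst (λ d′ → IsReading v d′ _ (word213At v d (a , j))) (m+[n∸m]≡n (<⇒≤ a<d))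
          (word213-isReading (suc m) a (d ∸ a) j (<⇒≤ j<va))
  complete : ∀ {D} → 𝒟 v d (p213 ∷ p321 ∷ []) D → perm D ∈ readings213 v d
  complete {D} (D∈@(_ , _ , labels) , ¬213 ∷ ¬321 ∷ []) =
    readings213-complete v d (subst (perm D ↭_) (oneTo≡interval _) labels) ¬213 ¬321
      (increasing-or-blockDescent middles-increasing-213 D∈ ¬213)

corollary3p9 : (v d : ℕ) → 4 ≤ v → 1 ≤ d →
    HasCard (𝒟 v d (p132 ∷ p321 ∷ [])) (1 + v * ((d * (d ∸ 1)) / 2)) ×
    HasCard (𝒟 v d (p213 ∷ p321 ∷ [])) (1 + v * ((d * (d ∸ 1)) / 2))
corollary3p9 _ d (s≤s (s≤s (s≤s {n = m} _))) 1≤d = card-𝒟-132-321 m d 1≤d , card-𝒟-213-321 m d 1≤d
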